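{- Let $m\geqslant4$ and let $H$, $K$, $h$, $x$, $\tau$, $y$, $z$ be as in the context. Then $x$, $y$ and $z$ are involutions (permutations of $H$ of order exactly $2$).
   Context: Permutations act on the right, written exponentially ($g^\sigma$), and a product $\sigma\rho$ means first $\sigma$ then $\rho$. Let $m\geqslant4$ be an integer and $H=\langle a,b\mid a^4=b^2=(ab)^2=1\rangle\times\langle c_1\rangle\times\cdots\times\langle c_{m-3}\rangle$, where $c_1,\dots,c_{m-3}$ are involutions (so $H\cong \mathrm{D}_8\times\mathbb{Z}_2^{m-3}$, $|H|=2^m$). Put $c_{ -1}=c_0=1$. Let $K=\langle a^2,b,c_1,\dots,c_{m-3}\rangle$ (an index-2 subgroup of $H$) and $h=a\prod_{i=0}^{\lceil(m-5)/2\rceil}c_{2i+1}$. Let $x\in\mathrm{Aut}(H)$ be defined by $a^x=a^{ -1}$, $b^x=ab$, $c_{2i+1}^x=c_{2i+1}$, $c_{2i+2}^x=a^2c_{2i+1}c_{2i+2}$ for $0\leqslant i\leqslant\lfloor(m-5)/2\rfloor$, and additionally $c_{m-3}^x=a^2c_{m-3}$ if $m$ is even. Let $\tau\in\mathrm{Aut}(K)$ be defined by $(a^2)^\tau=b$, $b^\tau=a^2$, $c_{2i+1}^\tau=c_{2i-1}c_{2i}c_{2i+2}$, $c_{2i+2}^\tau=c_{2i-1}c_{2i}c_{2i+1}$ for $0\leqslant i\leqslant\lfloor(m-5)/2\rfloor$, and additionally $c_{m-3}^\tau=c_{m-3}$ if $m$ is even. Let $R$ be the right regular representation of $H$, i.e.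 $R(g)$ is the permutation $u\mapsto ug$ of $H$. Let $y$ be the permutation of $H$ with $k^y=k^\tau$ and $(hk)^y=hk^\tau$ if $m$ is odd, $(hk)^y=hk^\tau c_{m-3}$ if $m$ is even, for all $k\in K$. Let $z=R(h)\,y\,R(h^{ -1})$ if $m$ is odd and $z=R(h)\,y\,R(h^{ -1}c_{m-3})$ if $m$ is even. -}

module Defs where

open import Data.Nat using (ℕ; zero; suc; _+_; _*_; _∸_; _<ᵇ_; _≤ᵇ_; _≡ᵇ_)
open import Data.Nat.DivMod using (_/_; _%_)
open import Data.Bool using (Bool; true; false; if_then_else_; _xor_; _∧_)
open import Data.Fin using (Fin; toℕ)
open import Data.Vec using (Vec; zipWith; replicate; tabulate; lookup)
open import Data.List using (List; foldr; map; allFin)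
open import Data.Product using (_×_; ∃)
open import Relation.Binary.PropositionalEquality using (_≡_; _≢_)

-- ℤ₄ (exponents of a)

data Z4 : Set where
  z0 z1 z2 z3 : Z4

_⊕_ : Z4 → Z4 → Z4
z0 ⊕ k = k
z1 ⊕ z0 = z1
z1 ⊕ z1 = z2
z1 ⊕ z2 = z3
z1 ⊕ z3 = z0
z2 ⊕ z0 = z2
z2 ⊕ z1 = z3
z2 ⊕ z2 = z0
z2 ⊕ z3 = z1
z3 ⊕ z0 = z3
z3 ⊕ z1 = z0
z3 ⊕ z2 = z1
z3 ⊕ z3 = z2

neg : Z4 → Z4
neg z0 = z0
neg z1 = z3
neg z2 = z2
neg z3 = z1

-- H = D₈ × ℤ₂^n  (n = m - 3).  The element ⟨ i , j , v ⟩ is the normal form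
--   a^i b^j c₁^{v₀} c₂^{v₁} ⋯ cₙ^{v_{n-1}}
-- (the c's are indexed 1-based in the paper, 0-based in the Vec).

record H (n : ℕ) : Set where
  constructor ⟨_,_,_⟩
  field
    aexp : Z4
    bexp : Bool
    cvec : Vec Bool n

module _ {n : ℕ} where

  -- multiplication: a^i b^j a^k b^l = a^(i + (-1)^j k) b^(j+l)  (b a b = a⁻¹)
  _·_ : H n → H n → H n
  ⟨ i , j , u ⟩ · ⟨ k , l , w ⟩ =
    ⟨ i ⊕ (if j then neg k else k) , j xor l , zipWith _xor_ u w ⟩
  infixl 7 _·_

  e : H n
  e = ⟨ z0 , false , replicate n false ⟩

  _⁻¹ : H n → H n
  ⟨ i , true  , u ⟩ ⁻¹ = ⟨ i , true , u ⟩
  ⟨ i , false , u ⟩ ⁻¹ = ⟨ neg i , false , u ⟩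

  ga gb a² : H n
  ga = ⟨ z1 , false , replicate n false ⟩
  gb = ⟨ z0 , true , replicate n false ⟩
  a² = ⟨ z2 , false , replicate n false ⟩

  -- cN j = c_j (1-based); cN 0 = c₀ = 1 (paper's convention c₋₁ = c₀ = 1,
  -- c₋₁ is realised below as cN (2i ∸ 1) with i = 0).
  cN : ℕ → H n
  cN zero    = e
  cN (suc j) = ⟨ z0 , false , tabulate (λ l → toℕ l ≡ᵇ j) ⟩

  gc : Fin n → H n
  gc k = cN (suc (toℕ k))

  prod : List (H n) → H n
  prod = foldr _·_ e

  powZ4 : H n → Z4 → H n
  powZ4 g z0 = e
  powZ4 g z1 = g
  powZ4 g z2 = g · g
  powZ4 g z3 = g · g · g

  powB : H n → Bool → H n
  powB g false = e
  powB g true  = g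

  extH : H n → H n → (Fin n → H n) → H n → H n
  extH A B C ⟨ i , j , v ⟩ =
    powZ4 A i · (powB B j · prod (map (λ k → powB (C k) (lookup v k)) (allFin n)))

  -- K = ⟨a², b, c₁,…⟩ = { a^i b^j ∏ c^v | i even }
  inK : H n → Bool
  inK ⟨ z0 , _ , _ ⟩ = true
  inK ⟨ z2 , _ , _ ⟩ = true
  inK ⟨ _ , _ , _ ⟩  = false

  a²exp : Z4 → Bool
  a²exp z2 = true
  a²exp _  = false

  -- The homomorphism K → H determined by images P, B, C k of a², b, c_{k+1}:
  -- (a²)^ε b^j ∏ c^v ↦ P^ε B^j ∏ (C k)^(v k)   (only used on K)
  extK : H n → H n → (Fin n → H n) → H n → H n
  extK P B C ⟨ i , j , v ⟩ =
    powB P (a²exp i) · (powB B j · prod (map (λ k → powB (C k) (lookup v k)) (allFin n)))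

even : ℕ → Bool
even m = m % 2 ≡ᵇ 0

-- For a 0-based index k (i.e. c_{k+1}) write i = k / 2: then c_{k+1} = c_{2i+1}
-- if k is even and c_{k+1} = c_{2i+2} if k is odd.  The range
-- 0 ≤ i ≤ ⌊(m-5)/2⌋ is equivalent to i < ⌊(m-3)/2⌋ = (m ∸ 3) / 2 (for m ≥ 4);
-- the remaining index (only when m is even) is c_{m-3}.

module _ (m : ℕ) where

  private
    n = m ∸ 3

  paired : Fin n → Bool
  paired k = (toℕ k / 2) <ᵇ (n / 2)

  xc : Fin n → H n
  xc k =
    if paired k
    then (if toℕ k % 2 ≡ᵇ 0
          then cN (suc (toℕ k))                                    -- c_{2i+1} ↦ c_{2i+1}
          else a² · cN (toℕ k) · cN (suc (toℕ k)))                 -- c_{2i+2} ↦ a² c_{2i+1} c_{2i+2}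
    else (if even m then a² · cN (suc (toℕ k)) else cN (suc (toℕ k)))  -- c_{m-3} ↦ a² c_{m-3} (m even)

  x : H n → H n
  x = extH (ga ⁻¹) (ga · gb) xc

  τc : Fin n → H n
  τc k =
    let i = toℕ k / 2 in
    if paired k
    then (if toℕ k % 2 ≡ᵇ 0
          then cN (2 * i ∸ 1) · cN (2 * i) · cN (2 * i + 2)        -- c_{2i+1} ↦ c_{2i-1} c_{2i} c_{2i+2}
          else cN (2 * i ∸ 1) · cN (2 * i) · cN (2 * i + 1))       -- c_{2i+2} ↦ c_{2i-1} c_{2i} c_{2i+1}
    else cN (suc (toℕ k))                                          -- c_{m-3} ↦ c_{m-3} (m even)

  τ : H n → H n
  τ = extK gb a² τc

  -- h = a ∏_{i=0}^{⌈(m-5)/2⌉} c_{2i+1};  for m ≥ 4, ⌈(m-5)/2⌉ = (m ∸ 4) / 2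
  h : H n
  h = ga · prod (map (λ k → if (toℕ k % 2 ≡ᵇ 0) ∧ ((toℕ k / 2) ≤ᵇ ((m ∸ 4) / 2))
                            then gc k else e) (allFin n))

  corr : H n
  corr = if even m then cN n else e

  y : H n → H n
  y g = if inK g then τ g else h · (τ (h ⁻¹ · g) · corr)

  z : H n → H n
  z g = y (g · h) · (h ⁻¹ · corr)

IsInvolution : {A : Set} → (A → A) → Set
IsInvolution {A} f = (∀ g → f (f g) ≡ g) × ∃ (λ g → f g ≢ g)

-- Write elements of H in normal form a^i b^j c^v with v ∈ 𝔽₂^(m-3). Each of x, τ, y, z maps
-- a^i b^j c^v to a^i′ b^j′ c^(L v + t), where L is the 𝔽₂-linear map whose columns are the c-parts
-- of the images of the c_k, (i′, j′) comes from a finite table and t depends only on the parity of i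
-- (for x, the a²-parts of the images of the c_k also enter i′). Each L is an involution because
-- L² fixes every column: x acts on a pair (c_{2i+1}, c_{2i+2}) as a transvection, and τ moves
-- c_{2i+1} and c_{2i+2} by the product c_{2i-1} c_{2i} of the previous pair, which τ fixes. On hK,
-- y and z are τ followed by a translation by a τ-fixed vector, hence involutions as well; x and y
-- move b and z moves a.

module Submission where

open import Algebra.Bundles using (CommutativeMonoid)
open import Algebra.Structures using (IsCommutativeMonoid)
open import Data.Bool using (Bool; true; false; if_then_else_; _xor_; _∧_; not; T)
open import Data.Bool.Properties using (xor-assoc; xor-comm; xor-identityˡ; xor-identityʳ; xor-same)
open import Data.Empty using (⊥-elim)
open import Data.Fin using (Fin; zero; suc; toℕ)
open import Data.Fin.Properties using (toℕ<n)
open import Data.List using ([]; _∷_; map; allFin)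
import Data.List as List
open import Data.List.Properties using (map-tabulate)
open import Data.Nat using (ℕ; zero; suc; _+_; _*_; _∸_; _/_; _%_; _<ᵇ_; _≤ᵇ_; _≡ᵇ_; _≤_; _<_; z≤n; s≤s)
open import Data.Nat.Properties using (+-comm; +-suc; ≤-refl; ≤-trans; n≤1+n; <-irrefl; <ᵇ⇒<; <⇒<ᵇ; _<?_)
open import Data.Nat.DivMod using (m/n≡1+[m∸n]/n; [m+n]%n≡m%n)
open import Data.Product using (∃; _×_; _,_; proj₁; proj₂)
open import Data.Sum using (_⊎_; inj₁; inj₂)
open import Data.Vec using (Vec; []; _∷_; zipWith; replicate; tabulate; lookup; head)
open import Data.Vec.Properties using (zipWith-assoc; zipWith-comm; zipWith-identityˡ; zipWith-identityʳ)
open import Function using (_∘_)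
open import Relation.Binary.PropositionalEquality
open import Relation.Binary.PropositionalEquality.Algebra using (isMagma)
open import Relation.Nullary using (¬_; yes; no)
open ≡-Reasoning

open import Defs
open H using (aexp; bexp; cvec)

private
  variable
    n n′ n″ : ℕ

-- Vectors over 𝔽₂

infixl 6 _⊞_

_⊞_ : Vec Bool n → Vec Bool n → Vec Bool n
_⊞_ = zipWith _xor_

0v : Vec Bool n
0v = replicate _ false

⊞-isCommutativeMonoid : IsCommutativeMonoid _≡_ _⊞_ (0v {n})
⊞-isCommutativeMonoid = record
  { isMonoid = record
    { isSemigroup = record { isMagma = isMagma _⊞_ ; assoc = zipWith-assoc xor-assoc }
    ; identity    = zipWith-identityˡ xor-identityˡ , zipWith-identityʳ xor-identityʳ
    }
  ; comm = zipWith-comm xor-comm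
  }

⊞-commutativeMonoid : ℕ → CommutativeMonoid _ _
⊞-commutativeMonoid n = record { isCommutativeMonoid = ⊞-isCommutativeMonoid {n} }

module _ {n : ℕ} where
  open CommutativeMonoid (⊞-commutativeMonoid n) public
    using () renaming (assoc to ⊞-assoc; comm to ⊞-comm; identityˡ to ⊞-identityˡ; identityʳ to ⊞-identityʳ)
  open import Algebra.Properties.CommutativeSemigroup
    (CommutativeMonoid.commutativeSemigroup (⊞-commutativeMonoid n)) public
    using () renaming (interchange to ⊞-interchange)

⊞-self : (u : Vec Bool n) → u ⊞ u ≡ 0v
⊞-self []      = refl
⊞-self (b ∷ u) = cong₂ _∷_ (xor-same b) (⊞-self u)

⊞-cancelˡ : (u w : Vec Bool n) → u ⊞ (u ⊞ w) ≡ w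
⊞-cancelˡ u w = begin
  u ⊞ (u ⊞ w) ≡⟨ ⊞-assoc u u w ⟨
  u ⊞ u ⊞ w   ≡⟨ cong (_⊞ w) (⊞-self u) ⟩
  0v ⊞ w      ≡⟨ ⊞-identityˡ w ⟩
  w           ∎

⊞-cancel-common : (s u w : Vec Bool n) → (s ⊞ u) ⊞ (s ⊞ w) ≡ u ⊞ w
⊞-cancel-common s u w = begin
  (s ⊞ u) ⊞ (s ⊞ w) ≡⟨ ⊞-interchange s u s w ⟩
  (s ⊞ s) ⊞ (u ⊞ w) ≡⟨ cong (_⊞ (u ⊞ w)) (⊞-self s) ⟩
  0v ⊞ (u ⊞ w)      ≡⟨ ⊞-identityˡ (u ⊞ w) ⟩
  u ⊞ w             ∎

basis : ℕ → Vec Bool n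
basis j = tabulate (λ l → toℕ l ≡ᵇ j)

scale : Bool → Vec Bool n → Vec Bool n
scale true  u = u
scale false u = 0v

lincomb : (Fin n → Vec Bool n′) → Vec Bool n → Vec Bool n′
lincomb C []      = 0v
lincomb C (b ∷ w) = scale b (C zero) ⊞ lincomb (C ∘ suc) w

lincomb-0v : (C : Fin n → Vec Bool n′) → lincomb C 0v ≡ 0v
lincomb-0v {zero}  C = refl
lincomb-0v {suc n} C = trans (⊞-identityˡ _) (lincomb-0v (C ∘ suc))

lincomb-zero : (w : Vec Bool n) → lincomb {n′ = n′} (λ _ → 0v) w ≡ 0v
lincomb-zero []          = refl
lincomb-zero (true ∷ w)  = trans (⊞-identityˡ _) (lincomb-zero w)
lincomb-zero (false ∷ w) = trans (⊞-identityˡ _) (lincomb-zero w)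

scale-xor : ∀ a b (u : Vec Bool n) → scale (a xor b) u ≡ scale a u ⊞ scale b u
scale-xor false b     u = sym (⊞-identityˡ _)
scale-xor true  false u = sym (⊞-identityʳ u)
scale-xor true  true  u = sym (⊞-self u)

lincomb-⊞ : (C : Fin n → Vec Bool n′) (u w : Vec Bool n) → lincomb C (u ⊞ w) ≡ lincomb C u ⊞ lincomb C w
lincomb-⊞ C []      []      = sym (⊞-identityˡ _)
lincomb-⊞ C (a ∷ u) (b ∷ w) = begin
  scale (a xor b) (C zero) ⊞ lincomb (C ∘ suc) (u ⊞ w)
    ≡⟨ cong₂ _⊞_ (scale-xor a b (C zero)) (lincomb-⊞ (C ∘ suc) u w) ⟩
  (scale a (C zero) ⊞ scale b (C zero)) ⊞ (lincomb (C ∘ suc) u ⊞ lincomb (C ∘ suc) w)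
    ≡⟨ ⊞-interchange _ _ _ _ ⟩
  lincomb C (a ∷ u) ⊞ lincomb C (b ∷ w) ∎

lincomb-scale : (C : Fin n → Vec Bool n′) (b : Bool) (u : Vec Bool n) →
                lincomb C (scale b u) ≡ scale b (lincomb C u)
lincomb-scale C true  u = refl
lincomb-scale C false u = lincomb-0v C

lincomb-∘ : (D : Fin n′ → Vec Bool n″) (C : Fin n → Vec Bool n′) (w : Vec Bool n) →
            lincomb D (lincomb C w) ≡ lincomb (lincomb D ∘ C) w
lincomb-∘ D C []      = lincomb-0v D
lincomb-∘ D C (b ∷ w) = begin
  lincomb D (scale b (C zero) ⊞ lincomb (C ∘ suc) w)
    ≡⟨ lincomb-⊞ D (scale b (C zero)) (lincomb (C ∘ suc) w) ⟩
  lincomb D (scale b (C zero)) ⊞ lincomb D (lincomb (C ∘ suc) w)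
    ≡⟨ cong₂ _⊞_ (lincomb-scale D b (C zero)) (lincomb-∘ D (C ∘ suc) w) ⟩
  scale b (lincomb D (C zero)) ⊞ lincomb (lincomb D ∘ C ∘ suc) w ∎

lincomb-cong : {C D : Fin n → Vec Bool n′} → C ≗ D → lincomb C ≗ lincomb D
lincomb-cong C≗D []      = refl
lincomb-cong C≗D (b ∷ w) = cong₂ _⊞_ (cong (scale b) (C≗D zero)) (lincomb-cong (C≗D ∘ suc) w)

lincomb-∘-columns : {D : Fin n′ → Vec Bool n″} {C : Fin n → Vec Bool n′} {E : Fin n → Vec Bool n″} →
                    (∀ k → lincomb D (C k) ≡ E k) → ∀ w → lincomb D (lincomb C w) ≡ lincomb E w
lincomb-∘-columns {D = D} {C} DC≗E w = trans (lincomb-∘ D C w) (lincomb-cong DC≗E w)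

tabulate-false : tabulate {n = n} (λ _ → false) ≡ 0v
tabulate-false {zero}  = refl
tabulate-false {suc n} = cong (false ∷_) tabulate-false

lincomb-basis : (D : ℕ → Vec Bool n′) {j : ℕ} → j < n → lincomb {n} (D ∘ toℕ) (basis j) ≡ D j
lincomb-basis {n = suc n} D {zero} _ = begin
  D 0 ⊞ lincomb {n} (D ∘ suc ∘ toℕ) (tabulate (λ _ → false))
    ≡⟨ cong (λ u → D 0 ⊞ lincomb (D ∘ suc ∘ toℕ) u) (tabulate-false {n}) ⟩
  D 0 ⊞ lincomb {n} (D ∘ suc ∘ toℕ) 0v
    ≡⟨ cong (D 0 ⊞_) (lincomb-0v {n} (D ∘ suc ∘ toℕ)) ⟩
  D 0 ⊞ 0v
    ≡⟨ ⊞-identityʳ (D 0) ⟩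
  D 0 ∎
lincomb-basis {n = suc n} D {suc j} (s≤s j<n) = trans (⊞-identityˡ _) (lincomb-basis (D ∘ suc) j<n)

lincomb-false∷ : (C : Fin n → Vec Bool n′) (w : Vec Bool n) →
                 lincomb (λ k → false ∷ C k) w ≡ false ∷ lincomb C w
lincomb-false∷ C []          = refl
lincomb-false∷ C (true ∷ w)  = cong ((false ∷ C zero) ⊞_) (lincomb-false∷ (C ∘ suc) w)
lincomb-false∷ C (false ∷ w) = cong ((false ∷ 0v) ⊞_) (lincomb-false∷ (C ∘ suc) w)

lincomb-basis-id : (w : Vec Bool n) → lincomb (basis ∘ toℕ) w ≡ w
lincomb-basis-id []      = refl
lincomb-basis-id (b ∷ w) = begin
  scale b (true ∷ tabulate (λ _ → false)) ⊞ lincomb (λ k → false ∷ basis (toℕ k)) w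
    ≡⟨ cong₂ (λ u v → scale b (true ∷ u) ⊞ v) tabulate-false (lincomb-false∷ (basis ∘ toℕ) w) ⟩
  scale b (true ∷ 0v) ⊞ (false ∷ lincomb (basis ∘ toℕ) w)
    ≡⟨ cong (λ v → scale b (true ∷ 0v) ⊞ (false ∷ v)) (lincomb-basis-id w) ⟩
  scale b (true ∷ 0v) ⊞ (false ∷ w)
    ≡⟨ head-column b ⟩
  b ∷ w ∎
  where
  head-column : ∀ b → scale b (true ∷ 0v) ⊞ (false ∷ w) ≡ b ∷ w
  head-column true  = cong (true ∷_) (⊞-identityˡ w)
  head-column false = cong (false ∷_) (⊞-identityˡ w)

lincomb-involutive : {C : Fin n → Vec Bool n} → (∀ k → lincomb C (C k) ≡ basis (toℕ k)) →
                     ∀ w → lincomb C (lincomb C w) ≡ w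
lincomb-involutive CC≗basis w = trans (lincomb-∘-columns CC≗basis w) (lincomb-basis-id w)

-- Normal forms in H

Z4-cases : {P : Z4 → Set} → P z0 → P z1 → P z2 → P z3 → ∀ i → P i
Z4-cases p₀ p₁ p₂ p₃ z0 = p₀
Z4-cases p₀ p₁ p₂ p₃ z1 = p₁
Z4-cases p₀ p₁ p₂ p₃ z2 = p₂
Z4-cases p₀ p₁ p₂ p₃ z3 = p₃

Bool-cases : {P : Bool → Set} → P false → P true → ∀ b → P b
Bool-cases p₀ p₁ false = p₀
Bool-cases p₀ p₁ true  = p₁

neg-⊕-involutive : ∀ i c → neg (neg i ⊕ c) ⊕ c ≡ i
neg-⊕-involutive = Z4-cases (Z4-cases refl refl refl refl) (Z4-cases refl refl refl refl)
                            (Z4-cases refl refl refl refl) (Z4-cases refl refl refl refl)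

⟨⟩-cong : ∀ {i i′ j j′} {v v′ : Vec Bool n} → i ≡ i′ → j ≡ j′ → v ≡ v′ → ⟨ i , j , v ⟩ ≡ ⟨ i′ , j′ , v′ ⟩
⟨⟩-cong refl refl refl = refl

isOdd : Z4 → Bool
isOdd z0 = false
isOdd z1 = true
isOdd z2 = false
isOdd z3 = true

a²^ : Bool → Z4
a²^ false = z0
a²^ true  = z2

-- The centre ⟨a²⟩ × ⟨c₁, …⟩ of H is 𝔽₂ × 𝔽₂ⁿ; the a²-coordinate is kept as a vector of length 1
-- so that it is computed by lincomb as well.
central : Vec Bool 1 → Vec Bool n → H n
central s v = ⟨ a²^ (head s) , false , v ⟩

data Central (s : Vec Bool 1) (g : H n) : Set where
  is-central : g ≡ central s (cvec g) → Central s g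

central-· : (s t : Vec Bool 1) (u w : Vec Bool n) → central s u · central t w ≡ central (s ⊞ t) (u ⊞ w)
central-· (false ∷ []) (false ∷ []) u w = refl
central-· (false ∷ []) (true ∷ [])  u w = refl
central-· (true ∷ [])  (false ∷ []) u w = refl
central-· (true ∷ [])  (true ∷ [])  u w = refl

Central-· : {s t : Vec Bool 1} {g g′ : H n} → Central s g → Central t g′ → Central (s ⊞ t) (g · g′)
Central-· {s = s} {t} {g} {g′} (is-central g≡) (is-central g′≡) =
  is-central (trans (cong₂ _·_ g≡ g′≡) (central-· s t (cvec g) (cvec g′)))

cN-Central : ∀ j → Central 0v (cN {n} j)
cN-Central zero    = is-central refl
cN-Central (suc j) = is-central refl

a²-Central : Central (true ∷ []) (a² {n})
a²-Central = is-central refl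

powB-central : {s : Vec Bool 1} {g : H n} → Central s g →
               ∀ b → powB g b ≡ central (scale b s) (scale b (cvec g))
powB-central (is-central g≡) true  = g≡
powB-central _                false = refl

prod-powers : {G : Fin n → H n′} {β : Fin n → Vec Bool 1} → (∀ k → Central (β k) (G k)) →
              ∀ w → prod (map (λ k → powB (G k) (lookup w k)) (allFin n))
                    ≡ central (lincomb β w) (lincomb (cvec ∘ G) w)
prod-powers G-central []                   = refl
prod-powers {G = G} {β} G-central (b ∷ w) = begin
  powB (G zero) b · prod (map (λ k → powB (G k) (lookup (b ∷ w) k)) (List.tabulate suc))
    ≡⟨ cong (λ gs → powB (G zero) b · prod gs) (map-allFin-suc (λ k → powB (G k) (lookup (b ∷ w) k))) ⟩
  powB (G zero) b · prod (map (λ k → powB (G (suc k)) (lookup w k)) (allFin _))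
    ≡⟨ cong₂ _·_ (powB-central (G-central zero) b) (prod-powers (G-central ∘ suc) w) ⟩
  central (scale b (β zero)) (scale b (cvec (G zero)))
    · central (lincomb (β ∘ suc) w) (lincomb (cvec ∘ G ∘ suc) w)
    ≡⟨ central-· (scale b (β zero)) _ (scale b (cvec (G zero))) _ ⟩
  central (lincomb β (b ∷ w)) (lincomb (cvec ∘ G) (b ∷ w)) ∎
  where
  map-allFin-suc : {A : Set} (f : Fin (suc _) → A) → map f (List.tabulate suc) ≡ map (f ∘ suc) (allFin _)
  map-allFin-suc f = trans (map-tabulate suc f) (sym (map-tabulate (λ k → k) (f ∘ suc)))

prod-Central : {G : Fin n → H n′} → (∀ k → Central 0v (G k)) → ∀ ks → Central 0v (prod (map G ks))
prod-Central G-central []       = is-central refl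
prod-Central G-central (k ∷ ks) = Central-· (G-central k) (prod-Central G-central ks)

a⁻¹-power : ∀ i → powZ4 (ga {n} ⁻¹) i ≡ ⟨ neg i , false , 0v ⟩
a⁻¹-power z0 = refl
a⁻¹-power z1 = refl
a⁻¹-power z2 = ⟨⟩-cong refl refl (⊞-identityˡ 0v)
a⁻¹-power z3 = ⟨⟩-cong refl refl (trans (cong (_⊞ 0v) (⊞-identityˡ 0v)) (⊞-identityˡ 0v))

ab-power : ∀ j → powB (ga {n} · gb) j ≡ ⟨ (if j then z1 else z0) , j , 0v ⟩
ab-power false = refl
ab-power true  = ⟨⟩-cong refl refl (⊞-identityˡ 0v)

⊞-identityˡ² : (u : Vec Bool n) → 0v ⊞ (0v ⊞ u) ≡ u
⊞-identityˡ² u = trans (⊞-identityˡ (0v ⊞ u)) (⊞-identityˡ u)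

module _ {L : Vec Bool n → Vec Bool n}
         (L-⊞ : ∀ u w → L (u ⊞ w) ≡ L u ⊞ L w) (L-involutive : ∀ v → L (L v) ≡ v) where

  affine-involutive : (F : H n → H n) (A : Z4 → Bool → Z4) (B : Z4 → Bool → Bool) (s : Z4 → Vec Bool n) →
                      (∀ i j v → F ⟨ i , j , v ⟩ ≡ ⟨ A i j , B i j , L v ⊞ s i ⟩) →
                      (∀ i j → A (A i j) (B i j) ≡ i × B (A i j) (B i j) ≡ j) →
                      (∀ i j → s (A i j) ≡ s i) → (∀ i → L (s i) ≡ s i) →
                      ∀ g → F (F g) ≡ g
  affine-involutive F A B s F-form AB-involutive s∘A≡s L-fixes-s ⟨ i , j , v ⟩ = begin
    F (F ⟨ i , j , v ⟩)
      ≡⟨ cong F (F-form i j v) ⟩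
    F ⟨ A i j , B i j , L v ⊞ s i ⟩
      ≡⟨ F-form _ _ _ ⟩
    ⟨ A (A i j) (B i j) , B (A i j) (B i j) , L (L v ⊞ s i) ⊞ s (A i j) ⟩
      ≡⟨ ⟨⟩-cong (proj₁ (AB-involutive i j)) (proj₂ (AB-involutive i j)) c-part ⟩
    ⟨ i , j , v ⟩ ∎
    where
    c-part : L (L v ⊞ s i) ⊞ s (A i j) ≡ v
    c-part = begin
      L (L v ⊞ s i) ⊞ s (A i j) ≡⟨ cong₂ _⊞_ (L-⊞ (L v) (s i)) (s∘A≡s i j) ⟩
      (L (L v) ⊞ L (s i)) ⊞ s i ≡⟨ cong₂ (λ u w → (u ⊞ w) ⊞ s i) (L-involutive v) (L-fixes-s i) ⟩
      (v ⊞ s i) ⊞ s i           ≡⟨ ⊞-assoc v (s i) (s i) ⟩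
      v ⊞ (s i ⊞ s i)           ≡⟨ cong (v ⊞_) (⊞-self (s i)) ⟩
      v ⊞ 0v                    ≡⟨ ⊞-identityʳ v ⟩
      v                         ∎

double : ℕ → ℕ
double zero    = zero
double (suc i) = suc (suc (double i))

half-suc-suc : ∀ t → suc (suc t) / 2 ≡ suc (t / 2)
half-suc-suc t = m/n≡1+[m∸n]/n {suc (suc t)} {2} (s≤s (s≤s z≤n))

mod2-suc-suc : ∀ t → suc (suc t) % 2 ≡ t % 2
mod2-suc-suc t = trans (cong (_% 2) (+-comm 2 t)) ([m+n]%n≡m%n t 2)

half-double : ∀ i → double i / 2 ≡ i
half-double zero    = refl
half-double (suc i) = trans (half-suc-suc (double i)) (cong suc (half-double i))

half-suc-double : ∀ i → suc (double i) / 2 ≡ i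
half-suc-double zero    = refl
half-suc-double (suc i) = trans (half-suc-suc (suc (double i))) (cong suc (half-suc-double i))

double-mod2 : ∀ i → double i % 2 ≡ 0
double-mod2 zero    = refl
double-mod2 (suc i) = trans (mod2-suc-suc (double i)) (double-mod2 i)

suc-double-mod2 : ∀ i → suc (double i) % 2 ≡ 1
suc-double-mod2 zero    = refl
suc-double-mod2 (suc i) = trans (mod2-suc-suc (suc (double i))) (suc-double-mod2 i)

2*≡double : ∀ i → 2 * i ≡ double i
2*≡double zero    = refl
2*≡double (suc i) = cong suc (trans (+-suc i (i + 0)) (cong suc (2*≡double i)))

parity : ∀ t → ∃ λ i → t ≡ double i ⊎ t ≡ suc (double i)
parity zero = 0 , inj₁ refl
parity (suc t) with parity t
... | i , inj₁ t≡2i   = i , inj₂ (cong suc t≡2i)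
... | i , inj₂ t≡2i+1 = suc i , inj₁ (cong suc t≡2i+1)

double-mono-≤ : ∀ {i j} → i ≤ j → double i ≤ double j
double-mono-≤ z≤n       = z≤n
double-mono-≤ (s≤s i≤j) = s≤s (s≤s (double-mono-≤ i≤j))

double-half-≤ : ∀ t → double (t / 2) ≤ t
double-half-≤ t with parity t
... | i , inj₁ refl rewrite half-double i     = ≤-refl
... | i , inj₂ refl rewrite half-suc-double i = n≤1+n _

<⇒<ᵇ≡true : ∀ {i j} → i < j → (i <ᵇ j) ≡ true
<⇒<ᵇ≡true {i} {j} i<j with i <ᵇ j | <⇒<ᵇ i<j
... | true | _ = refl

≮⇒<ᵇ≡false : ∀ {i j} → ¬ i < j → (i <ᵇ j) ≡ false
≮⇒<ᵇ≡false {i} {j} i≮j with i <ᵇ j in eq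
... | false = refl
... | true  = ⊥-elim (i≮j (<ᵇ⇒< i j (subst T (sym eq) _)))

-- The maps x, y and z

module Involutions (m : ℕ) where

  d p : ℕ
  d = m ∸ 3
  p = d / 2

  cv : ℕ → Vec Bool d
  cv j = cvec (cN j)

  -- The 0-based index t of c_{t+1} is the first or second member of a pair (c_{2i+1}, c_{2i+2})
  -- with i < p, or else it is the index of c_{m-3} for even m.
  data Position : ℕ → Set where
    first    : ∀ {i} → i < p → Position (double i)
    second   : ∀ {i} → i < p → Position (suc (double i))
    unpaired : ∀ {t} → (t / 2 <ᵇ p) ≡ false → Position t

  position : ∀ t → Position t
  position t with t / 2 <? p | parity t
  ... | no t/2≮p | _            = unpaired (≮⇒<ᵇ≡false t/2≮p)
  ... | yes t/2<p | i , inj₁ refl = first (subst (_< p) (half-double i) t/2<p)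
  ... | yes t/2<p | i , inj₂ refl = second (subst (_< p) (half-suc-double i) t/2<p)

  pair-bound : ∀ {i} → i < p → suc (double i) < d
  pair-bound i<p = ≤-trans (double-mono-≤ i<p) (double-half-≤ d)

  -- xc m k and τc m k are xcol (toℕ k) and τcol (toℕ k) by definition; indexing by ℕ lets
  -- Position refine the index.
  xcol : ℕ → H d
  xcol t = if t / 2 <ᵇ p
           then (if t % 2 ≡ᵇ 0 then cN (suc t) else a² · cN t · cN (suc t))
           else (if even m then a² · cN (suc t) else cN (suc t))

  xcol-a² : ℕ → Vec Bool 1
  xcol-a² t = (if t / 2 <ᵇ p then not (t % 2 ≡ᵇ 0) else even m) ∷ []

  xcol-Central : ∀ t → Central (xcol-a² t) (xcol t)
  xcol-Central t with t / 2 <ᵇ p | t % 2 ≡ᵇ 0 | even m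
  ... | true  | true  | _     = cN-Central (suc t)
  ... | true  | false | _     = Central-· (Central-· a²-Central (cN-Central t)) (cN-Central (suc t))
  ... | false | _     | true  = Central-· a²-Central (cN-Central (suc t))
  ... | false | _     | false = cN-Central (suc t)

  xᵥ : Vec Bool d → Vec Bool d
  xᵥ = lincomb {d} (cvec ∘ xcol ∘ toℕ)

  xₐ : Vec Bool d → Vec Bool 1
  xₐ = lincomb {d} (xcol-a² ∘ toℕ)

  x-form : ∀ i j v → x m ⟨ i , j , v ⟩ ≡ ⟨ neg i ⊕ ((if j then z1 else z0) ⊕ a²^ (head (xₐ v))) , j , xᵥ v ⟩
  x-form i j v = begin
    x m ⟨ i , j , v ⟩
      ≡⟨ cong (λ g → powZ4 (ga ⁻¹) i · (powB (ga · gb) j · g)) (prod-powers (xcol-Central ∘ toℕ) v) ⟩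
    powZ4 (ga ⁻¹) i · (powB (ga · gb) j · central (xₐ v) (xᵥ v))
      ≡⟨ cong₂ (λ g g′ → g · (g′ · central (xₐ v) (xᵥ v))) (a⁻¹-power i) (ab-power j) ⟩
    ⟨ neg i , false , 0v ⟩ · (⟨ (if j then z1 else z0) , j , 0v ⟩ · central (xₐ v) (xᵥ v))
      ≡⟨ ⟨⟩-cong (a-part j (xₐ v)) (xor-identityʳ j) (⊞-identityˡ² (xᵥ v)) ⟩
    ⟨ neg i ⊕ ((if j then z1 else z0) ⊕ a²^ (head (xₐ v))) , j , xᵥ v ⟩ ∎
    where
    a-part : ∀ j s → neg i ⊕ ((if j then z1 else z0) ⊕ (if j then neg (a²^ (head s)) else a²^ (head s)))
                     ≡ neg i ⊕ ((if j then z1 else z0) ⊕ a²^ (head s))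
    a-part false s            = refl
    a-part true  (false ∷ []) = refl
    a-part true  (true ∷ [])  = refl

  xcol-first : ∀ {i} → i < p → cvec (xcol (double i)) ≡ basis (double i)
  xcol-first {i} i<p rewrite half-double i | <⇒<ᵇ≡true i<p | double-mod2 i = refl

  xcol-second : ∀ {i} → i < p → cvec (xcol (suc (double i))) ≡ basis (double i) ⊞ basis (suc (double i))
  xcol-second {i} i<p rewrite half-suc-double i | <⇒<ᵇ≡true i<p | suc-double-mod2 i =
    cong (_⊞ basis (suc (double i))) (⊞-identityˡ (basis (double i)))

  xcol-unpaired : ∀ {t} → (t / 2 <ᵇ p) ≡ false → cvec (xcol t) ≡ basis t
  xcol-unpaired {t} t-unpaired rewrite t-unpaired with even m
  ... | true  = ⊞-identityˡ (basis t)
  ... | false = refl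

  xcol-a²-first : ∀ {i} → i < p → xcol-a² (double i) ≡ false ∷ []
  xcol-a²-first {i} i<p rewrite half-double i | <⇒<ᵇ≡true i<p | double-mod2 i = refl

  xcol-a²-second : ∀ {i} → i < p → xcol-a² (suc (double i)) ≡ true ∷ []
  xcol-a²-second {i} i<p rewrite half-suc-double i | <⇒<ᵇ≡true i<p | suc-double-mod2 i = refl

  xᵥ-xcol : ∀ t → t < d → xᵥ (cvec (xcol t)) ≡ basis t
  xᵥ-xcol t t<d with position t
  ... | first {i} i<p = begin
    xᵥ (cvec (xcol (double i))) ≡⟨ cong xᵥ (xcol-first i<p) ⟩
    xᵥ (basis (double i))       ≡⟨ lincomb-basis (cvec ∘ xcol) t<d ⟩
    cvec (xcol (double i))      ≡⟨ xcol-first i<p ⟩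
    basis (double i)            ∎
  ... | second {i} i<p = begin
    xᵥ (cvec (xcol (suc (double i))))
      ≡⟨ cong xᵥ (xcol-second i<p) ⟩
    xᵥ (basis (double i) ⊞ basis (suc (double i)))
      ≡⟨ lincomb-⊞ {d} (cvec ∘ xcol ∘ toℕ) (basis (double i)) (basis (suc (double i))) ⟩
    xᵥ (basis (double i)) ⊞ xᵥ (basis (suc (double i)))
      ≡⟨ cong₂ _⊞_ (lincomb-basis (cvec ∘ xcol) (≤-trans (n≤1+n _) t<d)) (lincomb-basis (cvec ∘ xcol) t<d) ⟩
    cvec (xcol (double i)) ⊞ cvec (xcol (suc (double i)))
      ≡⟨ cong₂ _⊞_ (xcol-first i<p) (xcol-second i<p) ⟩
    basis (double i) ⊞ (basis (double i) ⊞ basis (suc (double i)))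
      ≡⟨ ⊞-cancelˡ (basis (double i)) (basis (suc (double i))) ⟩
    basis (suc (double i)) ∎
  ... | unpaired t-unpaired = begin
    xᵥ (cvec (xcol t)) ≡⟨ cong xᵥ (xcol-unpaired t-unpaired) ⟩
    xᵥ (basis t)       ≡⟨ lincomb-basis (cvec ∘ xcol) t<d ⟩
    cvec (xcol t)      ≡⟨ xcol-unpaired t-unpaired ⟩
    basis t            ∎

  xₐ-xcol : ∀ t → t < d → xₐ (cvec (xcol t)) ≡ xcol-a² t
  xₐ-xcol t t<d with position t
  ... | first {i} i<p = trans (cong xₐ (xcol-first i<p)) (lincomb-basis xcol-a² t<d)
  ... | second {i} i<p = begin
    xₐ (cvec (xcol (suc (double i))))
      ≡⟨ cong xₐ (xcol-second i<p) ⟩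
    xₐ (basis (double i) ⊞ basis (suc (double i)))
      ≡⟨ lincomb-⊞ {d} (xcol-a² ∘ toℕ) (basis (double i)) (basis (suc (double i))) ⟩
    xₐ (basis (double i)) ⊞ xₐ (basis (suc (double i)))
      ≡⟨ cong₂ _⊞_ (lincomb-basis xcol-a² (≤-trans (n≤1+n _) t<d)) (lincomb-basis xcol-a² t<d) ⟩
    xcol-a² (double i) ⊞ xcol-a² (suc (double i))
      ≡⟨ cong₂ _⊞_ (xcol-a²-first i<p) (xcol-a²-second i<p) ⟩
    true ∷ []
      ≡⟨ xcol-a²-second i<p ⟨
    xcol-a² (suc (double i)) ∎
  ... | unpaired t-unpaired = trans (cong xₐ (xcol-unpaired t-unpaired)) (lincomb-basis xcol-a² t<d)

  x-involutive : ∀ g → x m (x m g) ≡ g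
  x-involutive ⟨ i , j , v ⟩ = begin
    x m (x m ⟨ i , j , v ⟩)
      ≡⟨ cong (x m) (x-form i j v) ⟩
    x m ⟨ neg i ⊕ c (xₐ v) , j , xᵥ v ⟩
      ≡⟨ x-form (neg i ⊕ c (xₐ v)) j (xᵥ v) ⟩
    ⟨ neg (neg i ⊕ c (xₐ v)) ⊕ c (xₐ (xᵥ v)) , j , xᵥ (xᵥ v) ⟩
      ≡⟨ cong (λ s → ⟨ neg (neg i ⊕ c (xₐ v)) ⊕ c s , j , xᵥ (xᵥ v) ⟩) xₐ-xᵥ ⟩
    ⟨ neg (neg i ⊕ c (xₐ v)) ⊕ c (xₐ v) , j , xᵥ (xᵥ v) ⟩
      ≡⟨ ⟨⟩-cong (neg-⊕-involutive i (c (xₐ v))) refl xᵥ-xᵥ ⟩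
    ⟨ i , j , v ⟩ ∎
    where
    c : Vec Bool 1 → Z4
    c s = (if j then z1 else z0) ⊕ a²^ (head s)
    xₐ-xᵥ : xₐ (xᵥ v) ≡ xₐ v
    xₐ-xᵥ = lincomb-∘-columns (λ k → xₐ-xcol (toℕ k) (toℕ<n k)) v
    xᵥ-xᵥ : xᵥ (xᵥ v) ≡ v
    xᵥ-xᵥ = lincomb-involutive (λ k → xᵥ-xcol (toℕ k) (toℕ<n k)) v

  x-moves-b : x m gb ≢ gb
  x-moves-b x-fixes-b with trans (sym (cong aexp (x-form z0 true 0v))) (cong aexp x-fixes-b)
  ... | a-exponents rewrite lincomb-0v {d} (xcol-a² ∘ toℕ) with a-exponents
  ...   | ()

  τcol : ℕ → H d
  τcol t = let i = t / 2 in
    if t / 2 <ᵇ p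
    then (if t % 2 ≡ᵇ 0
          then cN (2 * i ∸ 1) · cN (2 * i) · cN (2 * i + 2)
          else cN (2 * i ∸ 1) · cN (2 * i) · cN (2 * i + 1))
    else cN (suc t)

  cN³-Central : ∀ a b c → Central 0v (cN {d} a · cN b · cN c)
  cN³-Central a b c = Central-· (Central-· (cN-Central a) (cN-Central b)) (cN-Central c)

  τcol-Central : ∀ t → Central 0v (τcol t)
  τcol-Central t with t / 2 <ᵇ p | t % 2 ≡ᵇ 0
  ... | true  | true  = cN³-Central (2 * (t / 2) ∸ 1) (2 * (t / 2)) (2 * (t / 2) + 2)
  ... | true  | false = cN³-Central (2 * (t / 2) ∸ 1) (2 * (t / 2)) (2 * (t / 2) + 1)
  ... | false | _     = cN-Central (suc t)

  τᵥ : Vec Bool d → Vec Bool d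
  τᵥ = lincomb {d} (cvec ∘ τcol ∘ toℕ)

  τᵥ-⊞ : ∀ u w → τᵥ (u ⊞ w) ≡ τᵥ u ⊞ τᵥ w
  τᵥ-⊞ = lincomb-⊞ {d} (cvec ∘ τcol ∘ toℕ)

  τᵥ-0v : τᵥ 0v ≡ 0v
  τᵥ-0v = lincomb-0v {d} (cvec ∘ τcol ∘ toℕ)

  τ-form : ∀ i j v → τ m ⟨ i , j , v ⟩ ≡ ⟨ a²^ j , a²exp {d} i , τᵥ v ⟩
  τ-form i j v = begin
    τ m ⟨ i , j , v ⟩
      ≡⟨ cong (λ g → powB gb (a²exp {d} i) · (powB a² j · g)) (prod-powers (τcol-Central ∘ toℕ) v) ⟩
    powB gb (a²exp {d} i) · (powB a² j · central (lincomb (λ _ → 0v) v) (τᵥ v))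
      ≡⟨ cong (λ s → powB gb (a²exp {d} i) · (powB a² j · central s (τᵥ v))) (lincomb-zero v) ⟩
    powB gb (a²exp {d} i) · (powB a² j · central 0v (τᵥ v))
      ≡⟨ outer (a²exp {d} i) j ⟩
    ⟨ a²^ j , a²exp {d} i , τᵥ v ⟩ ∎
    where
    outer : ∀ b j → powB gb b · (powB a² j · central 0v (τᵥ v)) ≡ ⟨ a²^ j , b , τᵥ v ⟩
    outer false false = ⟨⟩-cong refl refl (⊞-identityˡ² (τᵥ v))
    outer false true  = ⟨⟩-cong refl refl (⊞-identityˡ² (τᵥ v))
    outer true  false = ⟨⟩-cong refl refl (⊞-identityˡ² (τᵥ v))
    outer true  true  = ⟨⟩-cong refl refl (⊞-identityˡ² (τᵥ v))

  pair-sum : ℕ → Vec Bool d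
  pair-sum i = cv (double i ∸ 1) ⊞ cv (double i)

  τcol-first : ∀ {i} → i < p → cvec (τcol (double i)) ≡ pair-sum i ⊞ basis (suc (double i))
  τcol-first {i} i<p
    rewrite half-double i | <⇒<ᵇ≡true i<p | double-mod2 i | 2*≡double i | +-comm (double i) 2 = refl

  τcol-second : ∀ {i} → i < p → cvec (τcol (suc (double i))) ≡ pair-sum i ⊞ basis (double i)
  τcol-second {i} i<p
    rewrite half-suc-double i | <⇒<ᵇ≡true i<p | suc-double-mod2 i | 2*≡double i | +-comm (double i) 1 = refl

  τcol-unpaired : ∀ {t} → (t / 2 <ᵇ p) ≡ false → cvec (τcol t) ≡ basis t
  τcol-unpaired t-unpaired rewrite t-unpaired = refl

  τᵥ-basis : ∀ {t} → t < d → τᵥ (basis t) ≡ cvec (τcol t)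
  τᵥ-basis = lincomb-basis (cvec ∘ τcol)

  τᵥ-pair-sum : ∀ {i} → i < p → τᵥ (pair-sum i) ≡ pair-sum i
  τᵥ-pair-sum {zero} _ = begin
    τᵥ (0v ⊞ 0v)    ≡⟨ τᵥ-⊞ 0v 0v ⟩
    τᵥ 0v ⊞ τᵥ 0v   ≡⟨ cong₂ _⊞_ τᵥ-0v τᵥ-0v ⟩
    0v ⊞ 0v         ∎
  τᵥ-pair-sum {suc i} i+1<p = begin
    τᵥ (basis (double i) ⊞ basis (suc (double i)))
      ≡⟨ τᵥ-⊞ (basis (double i)) (basis (suc (double i))) ⟩
    τᵥ (basis (double i)) ⊞ τᵥ (basis (suc (double i)))
      ≡⟨ cong₂ _⊞_ (τᵥ-basis (≤-trans (n≤1+n _) (pair-bound i<p))) (τᵥ-basis (pair-bound i<p)) ⟩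
    cvec (τcol (double i)) ⊞ cvec (τcol (suc (double i)))
      ≡⟨ cong₂ _⊞_ (τcol-first i<p) (τcol-second i<p) ⟩
    (pair-sum i ⊞ basis (suc (double i))) ⊞ (pair-sum i ⊞ basis (double i))
      ≡⟨ ⊞-cancel-common (pair-sum i) (basis (suc (double i))) (basis (double i)) ⟩
    basis (suc (double i)) ⊞ basis (double i)
      ≡⟨ ⊞-comm (basis (suc (double i))) (basis (double i)) ⟩
    basis (double i) ⊞ basis (suc (double i)) ∎
    where
    i<p : i < p
    i<p = ≤-trans (n≤1+n _) i+1<p

  τᵥ-τcol : ∀ t → t < d → τᵥ (cvec (τcol t)) ≡ basis t
  τᵥ-τcol t t<d with position t
  ... | first {i} i<p = begin
    τᵥ (cvec (τcol (double i)))                      ≡⟨ cong τᵥ (τcol-first i<p) ⟩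
    τᵥ (pair-sum i ⊞ basis (suc (double i)))         ≡⟨ τᵥ-⊞ (pair-sum i) (basis (suc (double i))) ⟩
    τᵥ (pair-sum i) ⊞ τᵥ (basis (suc (double i)))    ≡⟨ cong₂ _⊞_ (τᵥ-pair-sum i<p) (τᵥ-basis 2i+1<d) ⟩
    pair-sum i ⊞ cvec (τcol (suc (double i)))        ≡⟨ cong (pair-sum i ⊞_) (τcol-second i<p) ⟩
    pair-sum i ⊞ (pair-sum i ⊞ basis (double i))     ≡⟨ ⊞-cancelˡ (pair-sum i) (basis (double i)) ⟩
    basis (double i)                                 ∎
    where
    2i+1<d : suc (double i) < d
    2i+1<d = pair-bound i<p
  ... | second {i} i<p = begin
    τᵥ (cvec (τcol (suc (double i))))                ≡⟨ cong τᵥ (τcol-second i<p) ⟩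
    τᵥ (pair-sum i ⊞ basis (double i))               ≡⟨ τᵥ-⊞ (pair-sum i) (basis (double i)) ⟩
    τᵥ (pair-sum i) ⊞ τᵥ (basis (double i))          ≡⟨ cong₂ _⊞_ (τᵥ-pair-sum i<p) (τᵥ-basis 2i<d) ⟩
    pair-sum i ⊞ cvec (τcol (double i))              ≡⟨ cong (pair-sum i ⊞_) (τcol-first i<p) ⟩
    pair-sum i ⊞ (pair-sum i ⊞ basis (suc (double i)))
                                                     ≡⟨ ⊞-cancelˡ (pair-sum i) (basis (suc (double i))) ⟩
    basis (suc (double i))                           ∎
    where
    2i<d : double i < d
    2i<d = ≤-trans (n≤1+n _) t<d
  ... | unpaired t-unpaired = begin
    τᵥ (cvec (τcol t)) ≡⟨ cong τᵥ (τcol-unpaired t-unpaired) ⟩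
    τᵥ (basis t)       ≡⟨ τᵥ-basis t<d ⟩
    cvec (τcol t)      ≡⟨ τcol-unpaired t-unpaired ⟩
    basis t            ∎

  τᵥ-involutive : ∀ v → τᵥ (τᵥ v) ≡ v
  τᵥ-involutive = lincomb-involutive (λ k → τᵥ-τcol (toℕ k) (toℕ<n k))

  h-factor : Fin d → H d
  h-factor k = if (toℕ k % 2 ≡ᵇ 0) ∧ ((toℕ k / 2) ≤ᵇ ((m ∸ 4) / 2)) then gc k else e

  h-factor-Central : ∀ k → Central 0v (h-factor k)
  h-factor-Central k with (toℕ k % 2 ≡ᵇ 0) ∧ ((toℕ k / 2) ≤ᵇ ((m ∸ 4) / 2))
  ... | true  = cN-Central (suc (toℕ k))
  ... | false = is-central refl

  hᵥ cᵥ : Vec Bool d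
  hᵥ = cvec (h m)
  cᵥ = cvec (corr m)

  h-form : h m ≡ ⟨ z1 , false , hᵥ ⟩
  h-form with prod-Central h-factor-Central (allFin d)
  ... | is-central prod≡ = cong (ga ·_) prod≡

  corr-Central : Central 0v (corr m)
  corr-Central with even m
  ... | true  = cN-Central d
  ... | false = is-central refl

  corr-form : corr m ≡ central 0v cᵥ
  corr-form with corr-Central
  ... | is-central corr≡ = corr≡

  τᵥ-fixes-last : ∀ {a} → d ≡ suc (double a) → τᵥ (cv d) ≡ cv d
  τᵥ-fixes-last {a} d≡2a+1 = subst (λ t → τᵥ (cv t) ≡ cv t) (sym d≡2a+1) (begin
    τᵥ (basis (double a))  ≡⟨ τᵥ-basis 2a<d ⟩
    cvec (τcol (double a)) ≡⟨ τcol-unpaired 2a-unpaired ⟩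
    basis (double a)       ∎)
    where
    2a<d : double a < d
    2a<d = subst (double a <_) (sym d≡2a+1) ≤-refl
    2a-unpaired : (double a / 2 <ᵇ p) ≡ false
    2a-unpaired = ≮⇒<ᵇ≡false λ a<p →
      <-irrefl refl (subst₂ _<_ (half-double a) (trans (cong (_/ 2) d≡2a+1) (half-suc-double a)) a<p)

  τᵥ-cᵥ : τᵥ cᵥ ≡ cᵥ
  τᵥ-cᵥ with even m in m-even
  ... | false = τᵥ-0v
  ... | true with parity m
  ...   | a , inj₂ m≡2a+1
    with trans (sym m-even) (trans (cong even m≡2a+1) (cong (_≡ᵇ 0) (suc-double-mod2 a)))
  ...     | ()
  τᵥ-cᵥ | true | zero          , inj₁ m≡0    = subst (λ t → τᵥ (cv t) ≡ cv t) (sym (cong (_∸ 3) m≡0)) τᵥ-0v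
  τᵥ-cᵥ | true | suc zero      , inj₁ m≡2    = subst (λ t → τᵥ (cv t) ≡ cv t) (sym (cong (_∸ 3) m≡2)) τᵥ-0v
  τᵥ-cᵥ | true | suc (suc a)   , inj₁ m≡2a+4 = τᵥ-fixes-last (cong (_∸ 3) m≡2a+4)

  -- y and z act on the coset hK by τ followed by the translation by δ.
  δ : Vec Bool d
  δ = (hᵥ ⊞ τᵥ hᵥ) ⊞ cᵥ

  τᵥ-δ : τᵥ δ ≡ δ
  τᵥ-δ = begin
    τᵥ ((hᵥ ⊞ τᵥ hᵥ) ⊞ cᵥ)            ≡⟨ τᵥ-⊞ (hᵥ ⊞ τᵥ hᵥ) cᵥ ⟩
    τᵥ (hᵥ ⊞ τᵥ hᵥ) ⊞ τᵥ cᵥ           ≡⟨ cong₂ _⊞_ (τᵥ-⊞ hᵥ (τᵥ hᵥ)) τᵥ-cᵥ ⟩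
    (τᵥ hᵥ ⊞ τᵥ (τᵥ hᵥ)) ⊞ cᵥ         ≡⟨ cong (λ u → (τᵥ hᵥ ⊞ u) ⊞ cᵥ) (τᵥ-involutive hᵥ) ⟩
    (τᵥ hᵥ ⊞ hᵥ) ⊞ cᵥ                 ≡⟨ cong (_⊞ cᵥ) (⊞-comm (τᵥ hᵥ) hᵥ) ⟩
    (hᵥ ⊞ τᵥ hᵥ) ⊞ cᵥ                 ∎

  shift : Z4 → Vec Bool d
  shift i = if isOdd i then δ else 0v

  τᵥ-shift : ∀ i → τᵥ (shift i) ≡ shift i
  τᵥ-shift = Z4-cases τᵥ-0v τᵥ-δ τᵥ-0v τᵥ-δ

  δ-shift-flip : ∀ i j → δ ⊞ shift (i ⊕ (if j then z3 else z1)) ≡ shift i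
  δ-shift-flip = Z4-cases (Bool-cases (⊞-self δ) (⊞-self δ)) (Bool-cases (⊞-identityʳ δ) (⊞-identityʳ δ))
                          (Bool-cases (⊞-self δ) (⊞-self δ)) (Bool-cases (⊞-identityʳ δ) (⊞-identityʳ δ))

  open import Algebra.Solver.CommutativeMonoid (⊞-commutativeMonoid d)
    using (solve; _⊜_) renaming (_⊕_ to _⊞′_)

  hK-vector : ∀ v → hᵥ ⊞ (τᵥ (hᵥ ⊞ v) ⊞ cᵥ) ≡ τᵥ v ⊞ δ
  hK-vector v = begin
    hᵥ ⊞ (τᵥ (hᵥ ⊞ v) ⊞ cᵥ)      ≡⟨ cong (λ u → hᵥ ⊞ (u ⊞ cᵥ)) (τᵥ-⊞ hᵥ v) ⟩
    hᵥ ⊞ ((τᵥ hᵥ ⊞ τᵥ v) ⊞ cᵥ)   ≡⟨ solve 4 (λ h t u c → h ⊞′ ((t ⊞′ u) ⊞′ c) ⊜ u ⊞′ ((h ⊞′ t) ⊞′ c))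
                                           refl hᵥ (τᵥ hᵥ) (τᵥ v) cᵥ ⟩
    τᵥ v ⊞ δ                      ∎

  hK-product : ∀ b j v → ⟨ z1 , false , hᵥ ⟩ · (⟨ a²^ j , b , τᵥ (hᵥ ⊞ v) ⟩ · central 0v cᵥ)
                         ≡ ⟨ z1 ⊕ a²^ j , b , τᵥ v ⊞ δ ⟩
  hK-product false false v = ⟨⟩-cong refl refl (hK-vector v)
  hK-product false true  v = ⟨⟩-cong refl refl (hK-vector v)
  hK-product true  false v = ⟨⟩-cong refl refl (hK-vector v)
  hK-product true  true  v = ⟨⟩-cong refl refl (hK-vector v)

  yA : Z4 → Bool → Z4
  yA i j = (if isOdd i then z1 else z0) ⊕ a²^ j

  yB : Z4 → Bool
  yB z0 = false
  yB z1 = false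
  yB z2 = true
  yB z3 = true

  y-form : ∀ i j v → y m ⟨ i , j , v ⟩ ≡ ⟨ yA i j , yB i , τᵥ v ⊞ shift i ⟩
  y-form z0 j v = trans (τ-form z0 j v) (⟨⟩-cong refl refl (sym (⊞-identityʳ (τᵥ v))))
  y-form z2 j v = trans (τ-form z2 j v) (⟨⟩-cong refl refl (sym (⊞-identityʳ (τᵥ v))))
  y-form z1 j v = begin
    y m ⟨ z1 , j , v ⟩
      ≡⟨ cong₂ (λ g c → g · (τ m (g ⁻¹ · ⟨ z1 , j , v ⟩) · c)) h-form corr-form ⟩
    ⟨ z1 , false , hᵥ ⟩ · (τ m ⟨ z0 , j , hᵥ ⊞ v ⟩ · central 0v cᵥ)
      ≡⟨ cong (λ g → ⟨ z1 , false , hᵥ ⟩ · (g · central 0v cᵥ)) (τ-form z0 j (hᵥ ⊞ v)) ⟩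
    ⟨ z1 , false , hᵥ ⟩ · (⟨ a²^ j , false , τᵥ (hᵥ ⊞ v) ⟩ · central 0v cᵥ)
      ≡⟨ hK-product false j v ⟩
    ⟨ z1 ⊕ a²^ j , false , τᵥ v ⊞ δ ⟩ ∎
  y-form z3 j v = begin
    y m ⟨ z3 , j , v ⟩
      ≡⟨ cong₂ (λ g c → g · (τ m (g ⁻¹ · ⟨ z3 , j , v ⟩) · c)) h-form corr-form ⟩
    ⟨ z1 , false , hᵥ ⟩ · (τ m ⟨ z2 , j , hᵥ ⊞ v ⟩ · central 0v cᵥ)
      ≡⟨ cong (λ g → ⟨ z1 , false , hᵥ ⟩ · (g · central 0v cᵥ)) (τ-form z2 j (hᵥ ⊞ v)) ⟩
    ⟨ z1 , false , hᵥ ⟩ · (⟨ a²^ j , true , τᵥ (hᵥ ⊞ v) ⟩ · central 0v cᵥ)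
      ≡⟨ hK-product true j v ⟩
    ⟨ z1 ⊕ a²^ j , true , τᵥ v ⊞ δ ⟩ ∎

  y-involutive : ∀ g → y m (y m g) ≡ g
  y-involutive = affine-involutive τᵥ-⊞ τᵥ-involutive (y m) yA (λ i _ → yB i) shift y-form
    (Z4-cases (Bool-cases (refl , refl) (refl , refl)) (Bool-cases (refl , refl) (refl , refl))
              (Bool-cases (refl , refl) (refl , refl)) (Bool-cases (refl , refl) (refl , refl)))
    (Z4-cases (Bool-cases refl refl) (Bool-cases refl refl) (Bool-cases refl refl) (Bool-cases refl refl))
    τᵥ-shift

  y-moves-b : y m gb ≢ gb
  y-moves-b y-fixes-b with trans (sym (cong aexp (y-form z0 true 0v))) (cong aexp y-fixes-b)
  ... | ()

  zB : Z4 → Bool → Bool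
  zB z0 j = j
  zB z1 j = not j
  zB z2 j = not j
  zB z3 j = j

  z-exponents : ∀ i j (u w : Vec Bool d) →
    let i′ = i ⊕ (if j then z3 else z1) in
    ⟨ yA i′ (j xor false) , yB i′ , u ⟩ · ⟨ z3 , false , w ⟩ ≡ ⟨ i , zB i j , u ⊞ w ⟩
  z-exponents = Z4-cases (Bool-cases (λ _ _ → refl) (λ _ _ → refl)) (Bool-cases (λ _ _ → refl) (λ _ _ → refl))
                         (Bool-cases (λ _ _ → refl) (λ _ _ → refl)) (Bool-cases (λ _ _ → refl) (λ _ _ → refl))

  z-form : ∀ i j v → z m ⟨ i , j , v ⟩ ≡ ⟨ i , zB i j , τᵥ v ⊞ shift i ⟩
  z-form i j v = begin
    z m ⟨ i , j , v ⟩
      ≡⟨ cong₂ (λ g c → y m (⟨ i , j , v ⟩ · g) · (g ⁻¹ · c)) h-form corr-form ⟩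
    y m ⟨ i′ , j xor false , v ⊞ hᵥ ⟩ · ⟨ z3 , false , hᵥ ⊞ cᵥ ⟩
      ≡⟨ cong (_· ⟨ z3 , false , hᵥ ⊞ cᵥ ⟩) (y-form i′ (j xor false) (v ⊞ hᵥ)) ⟩
    ⟨ yA i′ (j xor false) , yB i′ , τᵥ (v ⊞ hᵥ) ⊞ shift i′ ⟩ · ⟨ z3 , false , hᵥ ⊞ cᵥ ⟩
      ≡⟨ z-exponents i j _ _ ⟩
    ⟨ i , zB i j , (τᵥ (v ⊞ hᵥ) ⊞ shift i′) ⊞ (hᵥ ⊞ cᵥ) ⟩
      ≡⟨ ⟨⟩-cong refl refl c-part ⟩
    ⟨ i , zB i j , τᵥ v ⊞ shift i ⟩ ∎
    where
    i′ : Z4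
    i′ = i ⊕ (if j then z3 else z1)
    c-part : (τᵥ (v ⊞ hᵥ) ⊞ shift i′) ⊞ (hᵥ ⊞ cᵥ) ≡ τᵥ v ⊞ shift i
    c-part = begin
      (τᵥ (v ⊞ hᵥ) ⊞ shift i′) ⊞ (hᵥ ⊞ cᵥ)
        ≡⟨ cong (λ u → (u ⊞ shift i′) ⊞ (hᵥ ⊞ cᵥ)) (τᵥ-⊞ v hᵥ) ⟩
      ((τᵥ v ⊞ τᵥ hᵥ) ⊞ shift i′) ⊞ (hᵥ ⊞ cᵥ)
        ≡⟨ solve 5 (λ u t s h c → ((u ⊞′ t) ⊞′ s) ⊞′ (h ⊞′ c) ⊜ u ⊞′ (((h ⊞′ t) ⊞′ c) ⊞′ s))
                   refl (τᵥ v) (τᵥ hᵥ) (shift i′) hᵥ cᵥ ⟩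
      τᵥ v ⊞ (δ ⊞ shift i′)
        ≡⟨ cong (τᵥ v ⊞_) (δ-shift-flip i j) ⟩
      τᵥ v ⊞ shift i ∎

  z-involutive : ∀ g → z m (z m g) ≡ g
  z-involutive = affine-involutive τᵥ-⊞ τᵥ-involutive (z m) (λ i _ → i) zB shift z-form
    (Z4-cases (Bool-cases (refl , refl) (refl , refl)) (Bool-cases (refl , refl) (refl , refl))
              (Bool-cases (refl , refl) (refl , refl)) (Bool-cases (refl , refl) (refl , refl)))
    (λ _ _ → refl)
    τᵥ-shift

  z-moves-a : z m ga ≢ ga
  z-moves-a z-fixes-a with trans (sym (cong bexp (z-form z1 false 0v))) (cong bexp z-fixes-a)
  ... | ()

lemma2p1 : (m : ℕ) → 4 ≤ m → IsInvolution (x m) × IsInvolution (y m) × IsInvolution (z m)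
lemma2p1 m _ =
  (x-involutive , gb , x-moves-b) , (y-involutive , gb , y-moves-b) , (z-involutive , ga , z-moves-a)
  where open Involutions m
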